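{- Let $G$ be a graph in the family $\mathscr{F}$, and suppose $G$ is isomorphic to neither $G_4$ nor $G_5$. Then $\gamma^{d}_2(G)\leq \frac{|V(G)|}{3}$.
   Context: All graphs are finite and simple. A set $S$ of vertices of a graph $G$ is a disjunctive dominating set of $G$ if every vertex not in $S$ is adjacent to a vertex of $S$ or has at least two vertices of $S$ at distance exactly $2$ from it in $G$; $\gamma^{d}_2(G)$ is the minimum cardinality of such a set. For $s\geq 3$ and $t\geq 1$, $C_{s,t}$ denotes the graph obtained from a cycle $C_s$ and a path with $t$ edges by identifying one end vertex of the path with a vertex of the cycle; the other end of the path is the leaf of $C_{s,t}$. Let $\mathscr{D}_1=\{C_{3,1},C_{3,2},C_{3,3},C_{4,1},C_{4,2},C_{4,3},C_{5,1},C_{5,2},C_{5,3}\}$ and $\mathscr{D}_2=\{C_3,C_4,C_5\}$. The family $\mathscr{F}$ consists of all graphs obtained as follows: take a single vertex $v$, graphs $A_1,\dots,A_t\in\mathscr{D}_1$ and $B_1,\dots,B_s\in\mathscr{D}_2$ (pairwise vertex-disjoint copies), where $s,t\geq 0$ and $s+t\geq 2$, and identify the leaf of each $A_i$ and one vertex of each $B_j$ with $v$. The graph $G_5$ is the graph on 8 vertices obtained from a $C_4$ and a $C_5$ by identifying one vertex of the $C_4$ with one vertex of the $C_5$. The graph $G_4$ is the graph on 8 vertices obtained from a $C_4$ and a $C_{4,1}$ by identifying the leaf of the $C_{4,1}$ with a vertex of the $C_4$ (equivalently, two disjoint $4$-cycles joined by a single edge). -}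

module Defs where

open import Data.Nat using (ℕ; zero; suc; _+_; _∸_; _<_; _≤_)
open import Data.Fin using (Fin; toℕ)
open import Data.Fin.Subset using (Subset; _∈_; _∉_)
open import Data.Product using (Σ; Σ-syntax; _×_; _,_)
open import Data.Sum using (_⊎_; inj₁; inj₂)
open import Data.Unit using (⊤; tt)
open import Data.List using (List; []; _∷_)
import Data.List.Membership.Propositional as LM
open import Relation.Binary.PropositionalEquality using (_≡_; _≢_)
open import Relation.Nullary using (¬_)
open import Function.Bundles using (_↔_; _⇔_; Inverse)

Iso : {V W : Set} → (V → V → Set) → (W → W → Set) → Set
Iso {V} {W} A B =
  Σ (V ↔ W) λ f → ∀ u v → A u v ⇔ B (Inverse.to f u) (Inverse.to f v)

module _ {n : ℕ} (Adj : Fin n → Fin n → Set) where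

  Dist2 : Fin n → Fin n → Set
  Dist2 u w = u ≢ w × ¬ Adj u w × Σ[ x ∈ Fin n ] (Adj u x × Adj x w)

  IsDisjDom : Subset n → Set
  IsDisjDom S =
    ∀ v → v ∉ S →
      (Σ[ u ∈ Fin n ] (u ∈ S × Adj v u))
      ⊎ (Σ[ a ∈ Fin n ] Σ[ b ∈ Fin n ]
           (a ≢ b × a ∈ S × b ∈ S × Dist2 v a × Dist2 v b))

-- A component is C_{s,t} (t ∈ {1,2,3}, a member of
-- D₁) or C_s (t = 0, a member of D₂), with s = 3 + cyc ∈ {3,4,5}.
-- Its vertices are labelled 0 .. s+t-1: the path is 0 - 1 - ... - t,
-- the cycle is t - (t+1) - ... - (t+s-1) - t.  Label 0 is the vertex
-- identified with the hub v (the leaf of C_{s,t}, resp. a vertex of C_s).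

record Comp : Set where
  field
    cyc  : Fin 3
    tail : Fin 4

open Comp public

cycLen : Comp → ℕ
cycLen c = 3 + toℕ (cyc c)

pathLen : Comp → ℕ
pathLen c = toℕ (tail c)

-- number of vertices of the component other than the glued vertex
-- (s + t - 1)
extra : Comp → ℕ
extra c = 2 + toℕ (cyc c) + toℕ (tail c)

LocalE : Comp → ℕ → ℕ → Set
LocalE c p q = (q ≡ suc p) ⊎ (p ≡ pathLen c × q ≡ pathLen c + cycLen c ∸ 1)

LocalAdj : Comp → ℕ → ℕ → Set
LocalAdj c p q = LocalE c p q ⊎ LocalE c q p

-- The graph of 𝓕 built from k components cs glued at a hub vertex v.
FV : (k : ℕ) → (Fin k → Comp) → Set
FV k cs = ⊤ ⊎ Σ[ i ∈ Fin k ] Fin (extra (cs i))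

emb : (k : ℕ) (cs : Fin k → Comp) (i : Fin k) → Fin (suc (extra (cs i))) → FV k cs
emb k cs i Fin.zero    = inj₁ tt
emb k cs i (Fin.suc x) = inj₂ (i , x)

FAdj : (k : ℕ) (cs : Fin k → Comp) → FV k cs → FV k cs → Set
FAdj k cs x y =
  Σ[ i ∈ Fin k ] Σ[ p ∈ Fin (suc (extra (cs i))) ] Σ[ q ∈ Fin (suc (extra (cs i))) ]
    (emb k cs i p ≡ x × emb k cs i q ≡ y × LocalAdj (cs i) (toℕ p) (toℕ q))

EdgeAdj : {n : ℕ} → List (ℕ × ℕ) → Fin n → Fin n → Set
EdgeAdj es u v = LM._∈_ (toℕ u , toℕ v) es ⊎ LM._∈_ (toℕ v , toℕ u) es

-- G₅ : C₄ = 0-1-2-3-0 and C₅ = 0-4-5-6-7-0 sharing vertex 0.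
G5 : Fin 8 → Fin 8 → Set
G5 = EdgeAdj ((0 , 1) ∷ (1 , 2) ∷ (2 , 3) ∷ (3 , 0)
           ∷ (0 , 4) ∷ (4 , 5) ∷ (5 , 6) ∷ (6 , 7) ∷ (7 , 0) ∷ [])

-- G₄ : 4-cycles 0-1-2-3-0 and 4-5-6-7-4 joined by the edge 0-4.
G4 : Fin 8 → Fin 8 → Set
G4 = EdgeAdj ((0 , 1) ∷ (1 , 2) ∷ (2 , 3) ∷ (3 , 0)
           ∷ (4 , 5) ∷ (5 , 6) ∷ (6 , 7) ∷ (7 , 4) ∷ (0 , 4) ∷ [])

{-# OPTIONS --safe #-}
-- Write the number s + t - 1 of vertices of a component other than the hub as 3q + r.
-- If the residues r add up to at least 2, the hub together with q suitable vertices of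
-- each component is a disjunctive dominating set, and 3(1 + Σ q) ≤ 1 + Σ (3q + r).
-- Otherwise every residue is at most 1 and the hub stays outside the set: each component
-- gets at most (s + t - 1)/3 vertices, and the hub is dominated either by a chosen
-- neighbour (in a C₃,₁, C₄,₃ or C₅,₂) or by chosen vertices at distance 2 in two
-- components.  In C₄,₁ and C₅ a vertex next to the hub is only at distance 2 from one
-- chosen vertex of its own component; the second one has to be a chosen neighbour of the
-- hub in another component.  If none exists, the residue count forces all other
-- components to be 4-cycles: with at least three components these then choose a
-- neighbour of the hub, and with two components the graph is G₄ or G₅.  The choices
-- inside each of the twelve component types are checked by exhaustive computation.
module Submission where

open import Defs
open import Data.Nat using (ℕ; _*_; _≤_)
open import Data.Fin using (Fin)
open import Data.Fin.Subset using (Subset; ∣_∣)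
open import Data.Product using (Σ-syntax; _×_)
open import Relation.Nullary using (¬_)

open import Data.Bool using (Bool; true; false; T; T?)
open import Data.Bool.Properties using (T-≡)
open import Data.Empty using (⊥; ⊥-elim)
open import Data.Fin using (zero; suc; toℕ; cast; _↑ˡ_; _↑ʳ_)
open import Data.Fin.Patterns using (0F; 1F; 2F)
open import Data.Fin.Permutation using (↔⇒≡; transpose)
open import Data.Fin.Properties
  using (_≟_; any?; all?; toℕ-injective; toℕ-cast; splitAt-↑ˡ; splitAt-↑ʳ; +↔⊎)
open import Data.Fin.Subset using (_∈_)
open import Data.List using (List; []; _∷_)
import Data.List.Membership.DecPropositional as DecMembership
open import Data.Nat using (zero; suc; _+_; _∸_; _%_; _≤?_; s≤s; z≤n)
import Data.Nat.Properties as ℕ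
open import Algebra.Properties.Semiring.Sum ℕ.+-*-semiring
  using (sum; sum-cong-≗; sum-permute; ∑-distrib-+; *-distribˡ-sum)
open import Data.Product using (Σ; _,_; proj₁; proj₂)
open import Data.Product.Function.NonDependent.Propositional using (_×-⇔_)
open import Data.Product.Properties using (≡-dec)
open import Data.Sum as Sum using (_⊎_; inj₁; inj₂; [_,_]′)
open import Data.Sum.Function.Propositional using (_⊎-↔_)
open import Data.Unit using (⊤; tt)
open import Data.Vec using (tabulate)
import Data.Vec.Functional as Vector
open import Data.Vec.Properties using (lookup∘tabulate; []=⇒lookup; lookup⇒[]=)
open import Function using (_∘_; _↔_; _⇔_; Inverse; Equivalence; mk⇔; mk↔ₛ′)
open import Function.Construct.Composition using (_↔-∘_; _⇔-∘_)
open import Function.Construct.Identity using (↔-id; ⇔-id)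
open import Function.Construct.Symmetry using (↔-sym; ⇔-sym)
open import Relation.Binary.PropositionalEquality
  using (_≡_; _≢_; ≢-sym; refl; sym; trans; cong; cong₂; subst; subst₂)
open import Relation.Nullary using (Dec; yes; no; ¬?; does)
open import Relation.Nullary.Decidable as Dec
  using (_×-dec_; _⊎-dec_; _→-dec_; map′; from-yes; True; toWitness)
open ℕ.≤-Reasoning

module Edge∈ = DecMembership (≡-dec ℕ._≟_ ℕ._≟_)
module Label∈ = DecMembership ℕ._≟_

-- Disjunctive domination in arbitrary graphs

module _ {V : Set} (A : V → V → Set) where

  AtDistance2 : V → V → Set
  AtDistance2 u w = u ≢ w × ¬ A u w × Σ[ x ∈ V ] (A u x × A x w)

  DisjDominated : (V → Set) → V → Set
  DisjDominated P v =
    (Σ[ u ∈ V ] (P u × A v u))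
    ⊎ (Σ[ a ∈ V ] Σ[ b ∈ V ] (a ≢ b × P a × P b × AtDistance2 v a × AtDistance2 v b))

  -- For V = Fin n and P = (_∈ S) this is IsDisjDom A S by definition.
  DisjDominating : (V → Set) → Set
  DisjDominating P = ∀ v → ¬ P v → DisjDominated P v

  DisjDominating-resp : ∀ {P Q : V → Set} → (∀ {v} → P v ⇔ Q v) → DisjDominating P → DisjDominating Q
  DisjDominating-resp P⇔Q dom v ¬Qv with dom v (¬Qv ∘ Equivalence.to P⇔Q)
  ... | inj₁ (u , Pu , a) = inj₁ (u , Equivalence.to P⇔Q Pu , a)
  ... | inj₂ (a , b , a≢b , Pa , Pb , da , db) =
    inj₂ (a , b , a≢b , Equivalence.to P⇔Q Pa , Equivalence.to P⇔Q Pb , da , db)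

module _ {n : ℕ} {A : Fin n → Fin n → Set} (A? : ∀ u v → Dec (A u v)) where

  atDistance2? : ∀ u w → Dec (AtDistance2 A u w)
  atDistance2? u w = ¬? (u ≟ w) ×-dec ¬? (A? u w) ×-dec any? (λ x → A? u x ×-dec A? x w)

  disjDominated? : {P : Fin n → Set} → (∀ v → Dec (P v)) → ∀ v → Dec (DisjDominated A P v)
  disjDominated? P? v =
    any? (λ u → P? u ×-dec A? v u)
    ⊎-dec any? λ a → any? λ b →
      ¬? (a ≟ b) ×-dec P? a ×-dec P? b ×-dec atDistance2? v a ×-dec atDistance2? v b

module _ {V W : Set} {A : V → V → Set} {B : W → W → Set} (φ : V ↔ W)
         (φ-adj : ∀ u v → A u v ⇔ B (Inverse.to φ u) (Inverse.to φ v)) where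
  open Inverse φ

  private
    to-from : ∀ w → to (from w) ≡ w
    to-from = strictlyInverseˡ

    from-adj : ∀ {u w} → B u w → A (from u) (from w)
    from-adj {u} {w} b = Equivalence.from (φ-adj _ _) (subst₂ B (sym (to-from u)) (sym (to-from w)) b)

    from-adj-to : ∀ {v w} → B (to v) w → A v (from w)
    from-adj-to {v} = subst (λ y → A y _) (strictlyInverseʳ v) ∘ from-adj

    from-dist2 : ∀ {v w} → AtDistance2 B (to v) w → AtDistance2 A v (from w)
    from-dist2 {v} {w} (v≢w , ¬b , x , b₁ , b₂) =
      (λ e → v≢w (trans (cong to e) (to-from w))) ,
      (λ a → ¬b (subst (B (to v)) (to-from w) (Equivalence.to (φ-adj _ _) a))) ,
      from x , from-adj-to b₁ , from-adj b₂

    from-≢ : ∀ {a b} → a ≢ b → from a ≢ from b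
    from-≢ {a} {b} a≢b e = a≢b (trans (sym (to-from a)) (trans (cong to e) (to-from b)))

  DisjDominating-transport : {P : W → Set} → DisjDominating B P → DisjDominating A (P ∘ to)
  DisjDominating-transport {P} dom v ¬P with dom (to v) ¬P
  ... | inj₁ (u , Pu , b) = inj₁ (from u , subst P (sym (to-from u)) Pu , from-adj-to b)
  ... | inj₂ (a , b , a≢b , Pa , Pb , da , db) =
    inj₂ (from a , from b , from-≢ a≢b , subst P (sym (to-from a)) Pa , subst P (sym (to-from b)) Pb ,
          from-dist2 da , from-dist2 db)

Iso-trans : ∀ {U V W : Set} {A : U → U → Set} {B : V → V → Set} {C : W → W → Set} →
  Iso A B → Iso B C → Iso A C
Iso-trans (f , f-adj) (g , g-adj) = g ↔-∘ f , λ u v → g-adj _ _ ⇔-∘ f-adj u v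

Iso-byInverse : ∀ {V W : Set} {A : V → V → Set} {B : W → W → Set} (g : W ↔ V) →
  (∀ a b → A (Inverse.to g a) (Inverse.to g b) ⇔ B a b) → Iso A B
Iso-byInverse {A = A} {B} g adj = ↔-sym g , λ u v →
  subst₂ (λ x y → A x y ⇔ B (from u) (from v)) (strictlyInverseˡ u) (strictlyInverseˡ v) (adj (from u) (from v))
  where open Inverse g

_⇔-dec_ : ∀ {P Q : Set} → Dec P → Dec Q → Dec (P ⇔ Q)
p? ⇔-dec q? = map′ (λ (f , g) → mk⇔ f g) (λ e → Equivalence.to e , Equivalence.from e)
                   ((p? →-dec q?) ×-dec (q? →-dec p?))

-- Finite sums and counting

indicator : Bool → ℕ
indicator true  = 1
indicator false = 0

size : ∀ {m} → (Fin m → Bool) → ℕ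
size X = sum (indicator ∘ X)

∣tabulate∣≡size : ∀ {n} (f : Fin n → Bool) → ∣ tabulate f ∣ ≡ size f
∣tabulate∣≡size {zero}  f = refl
∣tabulate∣≡size {suc n} f with f zero
... | true  = cong suc (∣tabulate∣≡size (f ∘ suc))
... | false = ∣tabulate∣≡size (f ∘ suc)

∈tabulate⇔ : ∀ {n} {f : Fin n → Bool} {v : Fin n} → v ∈ tabulate f ⇔ T (f v)
∈tabulate⇔ {f = f} {v} =
  mk⇔ (λ v∈ → Equivalence.from T-≡ (trans (sym (lookup∘tabulate f v)) ([]=⇒lookup v∈)))
      (λ t → lookup⇒[]= v (tabulate f) (trans (lookup∘tabulate f v) (Equivalence.to T-≡ t)))

sum-↑ : ∀ m {n} (g : Fin (m + n) → ℕ) → sum g ≡ sum (λ x → g (x ↑ˡ n)) + sum (λ y → g (m ↑ʳ y))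
sum-↑ zero    g = refl
sum-↑ (suc m) g = trans (cong (g zero +_) (sum-↑ m (g ∘ suc))) (sym (ℕ.+-assoc (g zero) _ _))

≤-sum : ∀ {k} (f : Fin k → ℕ) i → f i ≤ sum f
≤-sum f zero    = ℕ.m≤m+n (f zero) _
≤-sum f (suc i) = ℕ.≤-trans (≤-sum (f ∘ suc) i) (ℕ.m≤n+m _ (f zero))

sum≤⇒≤ : ∀ {k m} (f : Fin k → ℕ) → sum f ≤ m → ∀ i → f i ≤ m
sum≤⇒≤ f Σf≤m i = ℕ.≤-trans (≤-sum f i) Σf≤m

+-≤-sum : ∀ {k} (f : Fin k → ℕ) {i j} → i ≢ j → f i + f j ≤ sum f
+-≤-sum f {zero}  {zero}  i≢j = ⊥-elim (i≢j refl)
+-≤-sum f {zero}  {suc j} _   = ℕ.+-monoʳ-≤ (f zero) (≤-sum (f ∘ suc) j)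
+-≤-sum f {suc i} {zero}  _   =
  subst (_≤ sum f) (ℕ.+-comm (f zero) (f (suc i))) (ℕ.+-monoʳ-≤ (f zero) (≤-sum (f ∘ suc) i))
+-≤-sum f {suc i} {suc j} i≢j = ℕ.≤-trans (+-≤-sum (f ∘ suc) (i≢j ∘ cong suc)) (ℕ.m≤n+m _ (f zero))

sum-mono-≤ : ∀ {k} {f g : Fin k → ℕ} → (∀ i → f i ≤ g i) → sum f ≤ sum g
sum-mono-≤ {zero}  _   = z≤n
sum-mono-≤ {suc k} f≤g = ℕ.+-mono-≤ (f≤g zero) (sum-mono-≤ (f≤g ∘ suc))

Σ-suc↔ : ∀ {k} {F : Fin (suc k) → Set} → (F zero ⊎ Σ (Fin k) (F ∘ suc)) ↔ Σ (Fin (suc k)) F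
Σ-suc↔ {F = F} = mk↔ₛ′ [ (zero ,_) , (λ (i , y) → suc i , y) ]′ split
  (λ { (zero , _) → refl ; (suc _ , _) → refl }) (λ { (inj₁ _) → refl ; (inj₂ _) → refl })
  where
  split : Σ _ F → F zero ⊎ Σ _ (F ∘ suc)
  split (zero  , x) = inj₁ x
  split (suc i , y) = inj₂ (i , y)

Fin-sum↔Σ : ∀ k (e : Fin k → ℕ) → Fin (sum e) ↔ Σ (Fin k) (Fin ∘ e)
Fin-sum↔Σ zero    e = mk↔ₛ′ (λ ()) (λ ()) (λ ()) (λ ())
Fin-sum↔Σ (suc k) e = Σ-suc↔ ↔-∘ ((↔-id _ ⊎-↔ Fin-sum↔Σ k (e ∘ suc)) ↔-∘ +↔⊎)

sum-Fin-sum↔Σ : ∀ k (e : Fin k → ℕ) (w : Σ (Fin k) (Fin ∘ e) → ℕ) →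
  sum (w ∘ Inverse.to (Fin-sum↔Σ k e)) ≡ sum (λ i → sum (λ x → w (i , x)))
sum-Fin-sum↔Σ zero    e w = refl
sum-Fin-sum↔Σ (suc k) e w =
  trans (sum-↑ (e zero) _)
        (cong₂ _+_ (sum-cong-≗ first) (trans (sum-cong-≗ rest) (sum-Fin-sum↔Σ k (e ∘ suc) _)))
  where
  first : ∀ x → w (Inverse.to (Fin-sum↔Σ (suc k) e) (x ↑ˡ _)) ≡ w (zero , x)
  first x rewrite splitAt-↑ˡ (e zero) x (sum (e ∘ suc)) = refl
  rest : ∀ r → w (Inverse.to (Fin-sum↔Σ (suc k) e) (e zero ↑ʳ r)) ≡ _
  rest r rewrite splitAt-↑ʳ (e zero) (sum (e ∘ suc)) r = refl

Fin-suc↔ : ∀ {m} → Fin (suc m) ↔ (⊤ ⊎ Fin m)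
Fin-suc↔ = mk↔ₛ′ (λ { zero → inj₁ tt ; (suc j) → inj₂ j }) [ (λ _ → zero) , suc ]′
                 (λ { (inj₁ tt) → refl ; (inj₂ _) → refl }) (λ { zero → refl ; (suc _) → refl })

FV-enumeration : ∀ k (cs : Fin k → Comp) → Fin (suc (sum (extra ∘ cs))) ↔ FV k cs
FV-enumeration k cs = (↔-id ⊤ ⊎-↔ Fin-sum↔Σ k (extra ∘ cs)) ↔-∘ Fin-suc↔

module _ {n k : ℕ} {cs : Fin k → Comp} (φ : Fin n ↔ FV k cs) where
  open Inverse φ

  private
    π : Fin (suc (sum (extra ∘ cs))) ↔ Fin n
    π = ↔-sym φ ↔-∘ FV-enumeration k cs

  card-FV : n ≡ suc (sum (extra ∘ cs))
  card-FV = sym (↔⇒≡ π)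

  sum-FV : (w : FV k cs → ℕ) →
    sum (w ∘ to) ≡ w (inj₁ tt) + sum (λ i → sum (λ x → w (inj₂ (i , x))))
  sum-FV w = trans (sum-permute (w ∘ to) π)
    (trans (sum-cong-≗ (λ j → cong w (strictlyInverseˡ (Inverse.to (FV-enumeration k cs) j))))
           (cong (w (inj₁ tt) +_) (sum-Fin-sum↔Σ k (extra ∘ cs) (w ∘ inj₂))))

-- Components and the glued graph

Label : Comp → Set
Label c = Fin (suc (extra c))

LabelAdj : (c : Comp) → Label c → Label c → Set
LabelAdj c p q = LocalAdj c (toℕ p) (toℕ q)

localAdj? : ∀ c a b → Dec (LocalAdj c a b)
localAdj? c a b = localE? a b ⊎-dec localE? b a
  where
  localE? : ∀ a b → Dec (LocalE c a b)
  localE? a b = (b ℕ.≟ suc a) ⊎-dec ((a ℕ.≟ pathLen c) ×-dec (b ℕ.≟ pathLen c + cycLen c ∸ 1))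

labelAdj? : ∀ c p q → Dec (LabelAdj c p q)
labelAdj? c p q = localAdj? c (toℕ p) (toℕ q)

LocalAdj-cong : ∀ {c c′ a a′ b b′} → c ≡ c′ → a ≡ a′ → b ≡ b′ → LocalAdj c a b ⇔ LocalAdj c′ a′ b′
LocalAdj-cong refl refl refl = ⇔-id _

∀-Comp? : {P : Comp → Set} → (∀ c → Dec (P c)) → Dec (∀ c → P c)
∀-Comp? P? = map′ (λ all c → all (cyc c) (tail c)) (λ all a b → all _)
                  (all? λ a → all? λ b → P? record { cyc = a ; tail = b })

_≟ᶜ_ : (c d : Comp) → Dec (c ≡ d)
c ≟ᶜ d = map′ (λ (e₁ , e₂) → cong₂ (λ a b → record { cyc = a ; tail = b }) e₁ e₂)
              (λ e → cong cyc e , cong tail e) ((cyc c ≟ cyc d) ×-dec (tail c ≟ tail d))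

¬LocalAdj-hub : ∀ c → ¬ LocalAdj c 0 0
¬LocalAdj-hub = from-yes (∀-Comp? λ c → ¬? (localAdj? c 0 0))

module _ {k : ℕ} {cs : Fin k → Comp} where

  private
    E = emb k cs
    _~_ = FAdj k cs

  GluedAdj : FV k cs → FV k cs → Set
  GluedAdj (inj₁ _)       (inj₁ _)       = ⊥
  GluedAdj (inj₁ _)       (inj₂ (i , y)) = LocalAdj (cs i) 0 (suc (toℕ y))
  GluedAdj (inj₂ (i , x)) (inj₁ _)       = LocalAdj (cs i) (suc (toℕ x)) 0
  GluedAdj (inj₂ (i , x)) (inj₂ (j , y)) = i ≡ j × LocalAdj (cs i) (suc (toℕ x)) (suc (toℕ y))

  FAdj⇔GluedAdj : ∀ u v → u ~ v ⇔ GluedAdj u v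
  FAdj⇔GluedAdj u v = mk⇔ glued unglued
    where
    glued : ∀ {u v} → u ~ v → GluedAdj u v
    glued (i , zero  , zero  , refl , refl , a) = ¬LocalAdj-hub (cs i) a
    glued (i , zero  , suc y , refl , refl , a) = a
    glued (i , suc x , zero  , refl , refl , a) = a
    glued (i , suc x , suc y , refl , refl , a) = refl , a
    unglued : ∀ {u v} → GluedAdj u v → u ~ v
    unglued {inj₁ _}       {inj₂ (i , y)}  a          = i , zero , suc y , refl , refl , a
    unglued {inj₂ (i , x)} {inj₁ _}        a          = i , suc x , zero , refl , refl , a
    unglued {inj₂ (i , x)} {inj₂ (.i , y)} (refl , a) = i , suc x , suc y , refl , refl , a

  fAdj? : ∀ u v → Dec (u ~ v)
  fAdj? u v = Dec.map (⇔-sym (FAdj⇔GluedAdj u v)) (glued? u v)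
    where
    glued? : ∀ u v → Dec (GluedAdj u v)
    glued? (inj₁ _)       (inj₁ _)       = no λ ()
    glued? (inj₁ _)       (inj₂ (i , y)) = localAdj? (cs i) _ _
    glued? (inj₂ (i , x)) (inj₁ _)       = localAdj? (cs i) _ _
    glued? (inj₂ (i , x)) (inj₂ (j , y)) = (i ≟ j) ×-dec localAdj? (cs i) _ _

  emb-adj : ∀ i {p q} → LabelAdj (cs i) p q → E i p ~ E i q
  emb-adj i {p} {q} a = i , p , q , refl , refl , a

  emb-adj⁻ : ∀ i p q → E i p ~ E i q → LabelAdj (cs i) p q
  emb-adj⁻ i zero    zero    a = ⊥-elim (Equivalence.to (FAdj⇔GluedAdj _ _) a)
  emb-adj⁻ i zero    (suc y) a = Equivalence.to (FAdj⇔GluedAdj _ _) a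
  emb-adj⁻ i (suc x) zero    a = Equivalence.to (FAdj⇔GluedAdj _ _) a
  emb-adj⁻ i (suc x) (suc y) a = proj₂ (Equivalence.to (FAdj⇔GluedAdj _ _) a)

  emb-injective : ∀ i {p q} → E i p ≡ E i q → p ≡ q
  emb-injective i {zero}  {zero}   _    = refl
  emb-injective i {suc x} {suc .x} refl = refl

  emb-apart : ∀ {i j p q} → i ≢ j → p ≢ zero → E i p ≢ E j q
  emb-apart {p = zero}          _   p≢0 _    = p≢0 refl
  emb-apart {p = suc _} {zero}  _   _   ()
  emb-apart {p = suc _} {suc _} i≢j _   refl = i≢j refl

  emb-dist2 : ∀ i {p q} → AtDistance2 (LabelAdj (cs i)) p q → AtDistance2 _~_ (E i p) (E i q)
  emb-dist2 i {p} {q} (p≢q , ¬a , m , a₁ , a₂) =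
    p≢q ∘ emb-injective i , ¬a ∘ emb-adj⁻ i p q , E i m , emb-adj i a₁ , emb-adj i a₂

  dist2-via-hub : ∀ {i j x y} → i ≢ j →
    LabelAdj (cs i) (suc x) zero → LabelAdj (cs j) zero (suc y) →
    AtDistance2 _~_ (inj₂ (i , x)) (inj₂ (j , y))
  dist2-via-hub i≢j a₁ a₂ =
    emb-apart i≢j (λ ()) , i≢j ∘ proj₁ ∘ Equivalence.to (FAdj⇔GluedAdj _ _) ,
    inj₁ tt , emb-adj _ a₁ , emb-adj _ a₂

Σ-Fin-≡ : ∀ {m} {e : Fin m → ℕ} {i j : Fin m} {x : Fin (e i)} {y : Fin (e j)} →
  i ≡ j → toℕ x ≡ toℕ y → _≡_ {A = Σ (Fin m) (Fin ∘ e)} (i , x) (j , y)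
Σ-Fin-≡ refl x≡y = cong (_ ,_) (toℕ-injective x≡y)

FAdj-reindex : ∀ {k k′} {cs : Fin k → Comp} {cs′ : Fin k′ → Comp} (π : Fin k ↔ Fin k′) →
  (∀ i → cs i ≡ cs′ (Inverse.to π i)) → Iso (FAdj k cs) (FAdj k′ cs′)
FAdj-reindex {k} {k′} {cs} {cs′} π eq = mk↔ₛ′ f g f∘g g∘f , adj
  where
  open Inverse π
  eq′ : ∀ j → cs′ j ≡ cs (from j)
  eq′ j = sym (trans (eq (from j)) (cong cs′ (strictlyInverseˡ j)))

  f : FV k cs → FV k′ cs′
  f (inj₁ tt)      = inj₁ tt
  f (inj₂ (i , x)) = inj₂ (to i , cast (cong extra (eq i)) x)

  g : FV k′ cs′ → FV k cs
  g (inj₁ tt)      = inj₁ tt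
  g (inj₂ (j , y)) = inj₂ (from j , cast (cong extra (eq′ j)) y)

  f∘g : ∀ v → f (g v) ≡ v
  f∘g (inj₁ tt)      = refl
  f∘g (inj₂ (j , y)) = cong inj₂ (Σ-Fin-≡ (strictlyInverseˡ j)
    (trans (toℕ-cast _ (cast (cong extra (eq′ j)) y)) (toℕ-cast _ y)))

  g∘f : ∀ u → g (f u) ≡ u
  g∘f (inj₁ tt)      = refl
  g∘f (inj₂ (i , x)) = cong inj₂ (Σ-Fin-≡ (strictlyInverseʳ i)
    (trans (toℕ-cast _ (cast (cong extra (eq i)) x)) (toℕ-cast _ x)))

  to-injective : ∀ {i j} → to i ≡ to j → i ≡ j
  to-injective {i} {j} e = trans (sym (strictlyInverseʳ i)) (trans (cong from e) (strictlyInverseʳ j))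

  relabel : ∀ i (x : Fin (extra (cs i))) → suc (toℕ x) ≡ suc (toℕ (cast (cong extra (eq i)) x))
  relabel i x = cong suc (sym (toℕ-cast _ x))

  glued : ∀ u v → GluedAdj {cs = cs} u v ⇔ GluedAdj {cs = cs′} (f u) (f v)
  glued (inj₁ _)       (inj₁ _)       = ⇔-id ⊥
  glued (inj₁ _)       (inj₂ (i , y)) = LocalAdj-cong (eq i) refl (relabel i y)
  glued (inj₂ (i , x)) (inj₁ _)       = LocalAdj-cong (eq i) (relabel i x) refl
  glued (inj₂ (i , x)) (inj₂ (j , y)) =
    mk⇔ (cong to) to-injective ×-⇔ LocalAdj-cong (eq i) (relabel i x) (relabel j y)

  adj : ∀ u v → FAdj k cs u v ⇔ FAdj k′ cs′ (f u) (f v)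
  adj u v = ⇔-sym (FAdj⇔GluedAdj (f u) (f v)) ⇔-∘ (glued u v ⇔-∘ FAdj⇔GluedAdj u v)

module _ {k : ℕ} (cs : Fin k → Comp)
         {B : Fin (suc (sum (extra ∘ cs))) → Fin (suc (sum (extra ∘ cs))) → Set}
         (B? : ∀ a b → Dec (B a b)) where
  open Inverse (FV-enumeration k cs)

  FAdj-iso-byDecision : True (all? λ a → all? λ b → fAdj? {cs = cs} (to a) (to b) ⇔-dec B? a b) →
    Iso (FAdj k cs) B
  FAdj-iso-byDecision check = Iso-byInverse (FV-enumeration k cs) (toWitness check)

edgeAdj? : ∀ {n} (es : List (ℕ × ℕ)) (u v : Fin n) → Dec (EdgeAdj es u v)
edgeAdj? es u v = Edge∈._∈?_ (toℕ u , toℕ v) es ⊎-dec Edge∈._∈?_ (toℕ v , toℕ u) es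

pair : Comp → Comp → Fin 2 → Comp
pair a b zero       = a
pair a b (suc zero) = b

C₄ C₄,₁ C₅ : Comp
C₄   = record { cyc = 1F ; tail = 0F }
C₄,₁ = record { cyc = 1F ; tail = 1F }
C₅   = record { cyc = 2F ; tail = 0F }

G4-iso : Iso (FAdj 2 (pair C₄ C₄,₁)) G4
G4-iso = FAdj-iso-byDecision (pair C₄ C₄,₁) (edgeAdj? _) _

G5-iso : Iso (FAdj 2 (pair C₄ C₅)) G5
G5-iso = FAdj-iso-byDecision (pair C₄ C₅) (edgeAdj? _) _

-- Local domination certificates

Choice : Comp → Set
Choice c = Fin (extra c) → Bool

module _ (c : Comp) (L : Label c → Bool) where

  HubNeighbour : Set
  HubNeighbour = Σ[ q ∈ Label c ] (T (L q) × LabelAdj c zero q)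

  HubAtDistance2 : Set
  HubAtDistance2 = Σ[ q ∈ Label c ] (T (L q) × AtDistance2 (LabelAdj c) zero q)

  -- p is at distance 2 from a chosen a of its own component and, through the hub, from a
  -- chosen neighbour of the hub in any other component.
  DominatedThroughHub : Label c → Set
  DominatedThroughHub p =
    LabelAdj c p zero × Σ[ a ∈ Label c ] (T (L a) × AtDistance2 (LabelAdj c) p a)

  LocallyOK : Bool → Set
  LocallyOK viaHub = ∀ x → ¬ T (L (suc x)) →
    DisjDominated (LabelAdj c) (T ∘ L) (suc x) ⊎ (T viaHub × DominatedThroughHub (suc x))

module _ (c : Comp) (L : Label c → Bool) where

  hubNeighbour? : Dec (HubNeighbour c L)
  hubNeighbour? = any? λ q → T? (L q) ×-dec labelAdj? c zero q

  hubAtDistance2? : Dec (HubAtDistance2 c L)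
  hubAtDistance2? = any? λ q → T? (L q) ×-dec atDistance2? (labelAdj? c) zero q

  locallyOK? : ∀ viaHub → Dec (LocallyOK c L viaHub)
  locallyOK? viaHub = all? λ x → ¬? (T? (L (suc x))) →-dec
    (disjDominated? (labelAdj? c) (T? ∘ L) (suc x)
     ⊎-dec T? viaHub ×-dec labelAdj? c (suc x) zero
     ×-dec any? λ a → T? (L a) ×-dec atDistance2? (labelAdj? c) (suc x) a)

hubNeighbour-own : ∀ {c L} → HubNeighbour c L →
  Σ[ y ∈ Fin (extra c) ] (T (L (suc y)) × LabelAdj c zero (suc y))
hubNeighbour-own {c} (zero  , _ , a) = ⊥-elim (¬LocalAdj-hub c a)
hubNeighbour-own     (suc y , t , a) = y , t , a

module _ {k : ℕ} (cs : Fin k → Comp) (h : Bool) (X : (i : Fin k) → Choice (cs i)) where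

  private
    E = emb k cs
    _~_ = FAdj k cs

  local : (i : Fin k) → Label (cs i) → Bool
  local i = h Vector.∷ X i

  selection : FV k cs → Bool
  selection (inj₁ _)       = h
  selection (inj₂ (i , y)) = X i y

  HubDominated : Set
  HubDominated =
    (Σ[ i ∈ Fin k ] HubNeighbour (cs i) (local i))
    ⊎ (Σ[ i ∈ Fin k ] Σ[ j ∈ Fin k ]
         (i ≢ j × HubAtDistance2 (cs i) (local i) × HubAtDistance2 (cs j) (local j)))

  Selected : FV k cs → Set
  Selected = T ∘ selection

  private
    selected-emb : ∀ i p → T (local i p) → Selected (E i p)
    selected-emb i zero    t = t
    selected-emb i (suc y) t = t

    emb-dominated : ∀ i p → DisjDominated (LabelAdj (cs i)) (T ∘ local i) p → DisjDominated _~_ Selected (E i p)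
    emb-dominated i p (inj₁ (q , t , a)) = inj₁ (E i q , selected-emb i q t , emb-adj i a)
    emb-dominated i p (inj₂ (a , b , a≢b , ta , tb , da , db)) =
      inj₂ (E i a , E i b , a≢b ∘ emb-injective i , selected-emb i a ta , selected-emb i b tb ,
            emb-dist2 i da , emb-dist2 i db)

    hub-dominated : HubDominated → DisjDominated _~_ Selected (inj₁ tt)
    hub-dominated (inj₁ (i , q , t , a)) = inj₁ (E i q , selected-emb i q t , emb-adj i a)
    hub-dominated (inj₂ (i , j , i≢j , (q , t , d) , (q′ , t′ , d′))) =
      inj₂ (E i q , E j q′ , emb-apart i≢j (≢-sym (proj₁ d)) , selected-emb i q t , selected-emb j q′ t′ ,
            emb-dist2 i d , emb-dist2 j d′)

    dominated-through-hub : ∀ {i j x} → i ≢ j → DominatedThroughHub (cs i) (local i) (suc x) →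
      HubNeighbour (cs j) (local j) → DisjDominated _~_ Selected (inj₂ (i , x))
    dominated-through-hub i≢j (a₀ , a , t , d) nb with hubNeighbour-own nb
    ... | y , t′ , a′ =
      inj₂ (E _ a , inj₂ (_ , y) , emb-apart i≢j (λ { refl → proj₁ (proj₂ d) a₀ }) , selected-emb _ a t , t′ ,
            emb-dist2 _ d , dist2-via-hub i≢j a₀ a′)

  glue : (throughHub : Fin k → Bool) →
    (∀ i → LocallyOK (cs i) (local i) (throughHub i)) →
    (∀ i → T (throughHub i) → Σ[ j ∈ Fin k ] (i ≢ j × HubNeighbour (cs j) (local j))) →
    (¬ T h → HubDominated) →
    DisjDominating _~_ Selected
  glue _ ok throughHub-ok hub-ok (inj₁ tt)      ¬sel = hub-dominated (hub-ok ¬sel)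
  glue _ ok throughHub-ok hub-ok (inj₂ (i , x)) ¬sel with ok i x ¬sel
  ... | inj₁ d = emb-dominated i (suc x) d
  ... | inj₂ (e , d) with throughHub-ok i e
  ...   | j , i≢j , nb = dominated-through-hub i≢j d nb

record Plan (k : ℕ) (cs : Fin k → Comp) : Set where
  field
    hub           : Bool
    choice        : (i : Fin k) → Choice (cs i)
    throughHub    : Fin k → Bool
    locally-ok    : ∀ i → LocallyOK (cs i) (local cs hub choice i) (throughHub i)
    throughHub-ok : ∀ i → T (throughHub i) →
                    Σ[ j ∈ Fin k ] (i ≢ j × HubNeighbour (cs j) (local cs hub choice j))
    hub-ok        : ¬ T hub → HubDominated cs hub choice
    small         : 3 * (indicator hub + sum (λ i → size (choice i))) ≤ suc (sum (extra ∘ cs))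

realise : ∀ {n k} {Adj : Fin n → Fin n → Set} {cs : Fin k → Comp} →
  Iso Adj (FAdj k cs) → Plan k cs → Σ[ S ∈ Subset n ] (IsDisjDom Adj S × 3 * ∣ S ∣ ≤ n)
realise {n} {k} {Adj} {cs} (φ , φ-adj) plan = tabulate f , dominating , small′
  where
  open Plan plan
  f : Fin n → Bool
  f = selection cs hub choice ∘ Inverse.to φ

  dominating : IsDisjDom Adj (tabulate f)
  dominating = DisjDominating-resp Adj (⇔-sym ∈tabulate⇔)
    (DisjDominating-transport φ φ-adj (glue cs hub choice throughHub locally-ok throughHub-ok hub-ok))

  ∣S∣≡ : ∣ tabulate f ∣ ≡ indicator hub + sum (λ i → size (choice i))
  ∣S∣≡ = trans (∣tabulate∣≡size f) (sum-FV {cs = cs} φ (indicator ∘ selection cs hub choice))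

  small′ : 3 * ∣ tabulate f ∣ ≤ n
  small′ = subst₂ (λ s m → 3 * s ≤ m) (sym ∣S∣≡) (sym (card-FV {cs = cs} φ)) small

-- The twelve component types

residue : Comp → ℕ
residue c = extra c % 3

labelSet : (c : Comp) → List ℕ → Choice c
labelSet c L y = does (Label∈._∈?_ (suc (toℕ y)) L)

-- For C_{s,t} (arguments s and t), ⌊(s + t - 1)/3⌋ labels dominating it together with the hub.
hubLabels : ℕ → ℕ → List ℕ
hubLabels 3 1 = 1 ∷ []
hubLabels 3 2 = 2 ∷ []
hubLabels 3 3 = 3 ∷ []
hubLabels 4 0 = 1 ∷ []
hubLabels 4 1 = 2 ∷ []
hubLabels 4 2 = 4 ∷ []
hubLabels 4 3 = 1 ∷ 5 ∷ []
hubLabels 5 0 = 1 ∷ []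
hubLabels 5 1 = 3 ∷ []
hubLabels 5 2 = 1 ∷ 4 ∷ []
hubLabels 5 3 = 2 ∷ 5 ∷ []
hubLabels _ _ = []

-- The labels chosen when the hub is not; the flag decides whether a C₄ takes the hub's
-- neighbour 1 or the opposite vertex 2.  Components of residue 2 never get here.
outsideLabels : Bool → ℕ → ℕ → List ℕ
outsideLabels _     3 1 = 1 ∷ []
outsideLabels _     3 2 = 2 ∷ []
outsideLabels true  4 0 = 1 ∷ []
outsideLabels false 4 0 = 2 ∷ []
outsideLabels _     4 1 = 3 ∷ []
outsideLabels _     4 3 = 1 ∷ 5 ∷ []
outsideLabels _     5 0 = 2 ∷ []
outsideLabels _     5 2 = 1 ∷ 4 ∷ []
outsideLabels _     5 3 = 2 ∷ 5 ∷ []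
outsideLabels _     _ _ = []

throughHubTable : Bool → ℕ → ℕ → Bool
throughHubTable b 4 0 = b
throughHubTable _ 4 1 = true
throughHubTable _ 5 0 = true
throughHubTable _ _ _ = false

hubChoice : (c : Comp) → Choice c
hubChoice c = labelSet c (hubLabels (cycLen c) (pathLen c))

outsideChoice : Bool → (c : Comp) → Choice c
outsideChoice b c = labelSet c (outsideLabels b (cycLen c) (pathLen c))

Outside : Bool → (c : Comp) → Label c → Bool
Outside b c = false Vector.∷ outsideChoice b c

outsideThroughHub : Bool → Comp → Bool
outsideThroughHub b c = throughHubTable b (cycLen c) (pathLen c)

hubChoice-ok : ∀ c → LocallyOK c (true Vector.∷ hubChoice c) false
hubChoice-ok = from-yes (∀-Comp? λ c → locallyOK? c (true Vector.∷ hubChoice c) false)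

hubChoice-size : ∀ c → 3 * size (hubChoice c) + residue c ≡ extra c
hubChoice-size = from-yes (∀-Comp? λ c → 3 * size (hubChoice c) + residue c ℕ.≟ extra c)

outsideChoice-ok : ∀ b c → residue c ≤ 1 → LocallyOK c (Outside b c) (outsideThroughHub b c)
outsideChoice-ok true  = from-yes (∀-Comp? λ c →
  residue c ≤? 1 →-dec locallyOK? c (Outside true c) (outsideThroughHub true c))
outsideChoice-ok false = from-yes (∀-Comp? λ c →
  residue c ≤? 1 →-dec locallyOK? c (Outside false c) (outsideThroughHub false c))

outsideChoice-size : ∀ b c → residue c ≤ 1 → 3 * size (outsideChoice b c) ≤ extra c
outsideChoice-size true  = from-yes (∀-Comp? λ c →
  residue c ≤? 1 →-dec 3 * size (outsideChoice true c) ≤? extra c)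
outsideChoice-size false = from-yes (∀-Comp? λ c →
  residue c ≤? 1 →-dec 3 * size (outsideChoice false c) ≤? extra c)

hubNeighbour⇒¬throughHub : ∀ c → HubNeighbour c (Outside false c) → ¬ T (outsideThroughHub false c)
hubNeighbour⇒¬throughHub = from-yes (∀-Comp? λ c →
  hubNeighbour? c (Outside false c) →-dec ¬? (T? (outsideThroughHub false c)))

hubAtDistance2 : ∀ c → residue c ≤ 1 → ¬ HubNeighbour c (Outside false c) → ¬ T (outsideThroughHub false c) →
  HubAtDistance2 c (Outside false c)
hubAtDistance2 = from-yes (∀-Comp? λ c →
  residue c ≤? 1 →-dec ¬? (hubNeighbour? c (Outside false c)) →-dec
  ¬? (T? (outsideThroughHub false c)) →-dec hubAtDistance2? c (Outside false c))

throughHub⇒C₄,₁⊎C₅ : ∀ c → T (outsideThroughHub false c) → c ≡ C₄,₁ ⊎ c ≡ C₅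
throughHub⇒C₄,₁⊎C₅ = from-yes (∀-Comp? λ c → T? (outsideThroughHub false c) →-dec (c ≟ᶜ C₄,₁ ⊎-dec c ≟ᶜ C₅))

residue0⇒C₄ : ∀ c → residue c ≡ 0 → ¬ HubNeighbour c (Outside false c) → c ≡ C₄
residue0⇒C₄ = from-yes (∀-Comp? λ c →
  residue c ℕ.≟ 0 →-dec ¬? (hubNeighbour? c (Outside false c)) →-dec c ≟ᶜ C₄)

C₄-hubNeighbour : HubNeighbour C₄ (Outside true C₄)
C₄-hubNeighbour = from-yes (hubNeighbour? C₄ (Outside true C₄))

-- Choosing a plan

module _ {k : ℕ} (cs : Fin k → Comp) where

  hubPlan : 2 ≤ sum (residue ∘ cs) → Plan k cs
  hubPlan 2≤R = record
    { hub           = true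
    ; choice        = hubChoice ∘ cs
    ; throughHub    = λ _ → false
    ; locally-ok    = hubChoice-ok ∘ cs
    ; throughHub-ok = λ _ ()
    ; hub-ok        = λ ¬t → ⊥-elim (¬t tt)
    ; small         = small
    }
    where
    S = sum (size ∘ hubChoice ∘ cs)
    R = sum (residue ∘ cs)

    total : sum (extra ∘ cs) ≡ 3 * S + R
    total = begin-equality
      sum (extra ∘ cs)
        ≡⟨ sum-cong-≗ (sym ∘ hubChoice-size ∘ cs) ⟩
      sum (λ i → 3 * size (hubChoice (cs i)) + residue (cs i))
        ≡⟨ ∑-distrib-+ (λ i → 3 * size (hubChoice (cs i))) _ ⟩
      sum (λ i → 3 * size (hubChoice (cs i))) + R
        ≡⟨ cong (_+ R) (*-distribˡ-sum 3 (size ∘ hubChoice ∘ cs)) ⟨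
      3 * S + R ∎

    small : 3 * (1 + S) ≤ suc (sum (extra ∘ cs))
    small = begin
      3 * (1 + S)            ≡⟨ ℕ.*-distribˡ-+ 3 1 S ⟩
      suc (2 + 3 * S)        ≤⟨ s≤s (ℕ.+-monoˡ-≤ (3 * S) 2≤R) ⟩
      suc (R + 3 * S)        ≡⟨ cong suc (trans (ℕ.+-comm R (3 * S)) (sym total)) ⟩
      suc (sum (extra ∘ cs)) ∎

  outsidePlan : (b : Bool) → (∀ i → residue (cs i) ≤ 1) →
    (∀ i → T (outsideThroughHub b (cs i)) → Σ[ j ∈ Fin k ] (i ≢ j × HubNeighbour (cs j) (Outside b (cs j)))) →
    HubDominated cs false (λ i → outsideChoice b (cs i)) → Plan k cs
  outsidePlan b r≤1 throughHub-ok hub-dominated = record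
    { hub           = false
    ; choice        = λ i → outsideChoice b (cs i)
    ; throughHub    = λ i → outsideThroughHub b (cs i)
    ; locally-ok    = λ i → outsideChoice-ok b (cs i) (r≤1 i)
    ; throughHub-ok = throughHub-ok
    ; hub-ok        = λ _ → hub-dominated
    ; small         = small
    }
    where
    small : 3 * sum (λ i → size (outsideChoice b (cs i))) ≤ suc (sum (extra ∘ cs))
    small = begin
      3 * sum (λ i → size (outsideChoice b (cs i))) ≡⟨ *-distribˡ-sum 3 (λ i → size (outsideChoice b (cs i))) ⟩
      sum (λ i → 3 * size (outsideChoice b (cs i))) ≤⟨ sum-mono-≤ (λ i → outsideChoice-size b (cs i) (r≤1 i)) ⟩
      sum (extra ∘ cs)                              ≤⟨ ℕ.n≤1+n _ ⟩
      suc (sum (extra ∘ cs))                        ∎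

  neighbourPlan : (∀ i → residue (cs i) ≤ 1) →
    (j : Fin k) → HubNeighbour (cs j) (Outside false (cs j)) → Plan k cs
  neighbourPlan r≤1 j nb =
    outsidePlan false r≤1 (λ i e → j , (λ { refl → hubNeighbour⇒¬throughHub (cs i) nb e }) , nb) (inj₁ (j , nb))

  others-C₄ : sum (residue ∘ cs) ≤ 1 → (∀ i → ¬ HubNeighbour (cs i) (Outside false (cs i))) →
    (w : Fin k) → T (outsideThroughHub false (cs w)) → ∀ i → i ≢ w → cs i ≡ C₄
  others-C₄ R≤1 ¬nb w e i i≢w = residue0⇒C₄ (cs i) (ℕ.n≤0⇒n≡0 (ℕ.≤-pred 1+r≤1)) (¬nb i)
    where
    residue-w : residue (cs w) ≡ 1
    residue-w = [ cong residue , cong residue ]′ (throughHub⇒C₄,₁⊎C₅ (cs w) e)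
    1+r≤1 : 1 + residue (cs i) ≤ 1
    1+r≤1 = subst (_≤ 1) (trans (cong (residue (cs i) +_) residue-w) (ℕ.+-comm _ 1))
                  (ℕ.≤-trans (+-≤-sum (residue ∘ cs) i≢w) R≤1)

twoComponents : (cs : Fin 2 → Comp) (w : Fin 2) → cs w ≡ C₄,₁ ⊎ cs w ≡ C₅ →
  (∀ i → i ≢ w → cs i ≡ C₄) → Iso (FAdj 2 cs) G4 ⊎ Iso (FAdj 2 cs) G5
twoComponents cs w W others =
  Sum.map (Iso-trans {C = G4} (reindexed w others)) (Iso-trans {C = G5} (reindexed w others)) (exceptional W)
  where
  exceptional : ∀ {a} → a ≡ C₄,₁ ⊎ a ≡ C₅ → Iso (FAdj 2 (pair C₄ a)) G4 ⊎ Iso (FAdj 2 (pair C₄ a)) G5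
  exceptional (inj₁ refl) = inj₁ G4-iso
  exceptional (inj₂ refl) = inj₂ G5-iso

  reindexed : ∀ w → (∀ i → i ≢ w → cs i ≡ C₄) → Iso (FAdj 2 cs) (FAdj 2 (pair C₄ (cs w)))
  reindexed 0F others = FAdj-reindex (transpose 0F 1F) swapped
    where
    swapped : ∀ i → cs i ≡ pair C₄ (cs 0F) (Inverse.to (transpose 0F 1F) i)
    swapped 0F = refl
    swapped 1F = others 1F (λ ())
  reindexed 1F others = FAdj-reindex (↔-id _) kept
    where
    kept : ∀ i → cs i ≡ pair C₄ (cs 1F) i
    kept 0F = others 0F (λ ())
    kept 1F = refl

atDistance2Plan : ∀ {k} (cs : Fin k → Comp) → 2 ≤ k → (∀ i → residue (cs i) ≤ 1) →
  (∀ i → ¬ HubNeighbour (cs i) (Outside false (cs i))) → (∀ i → ¬ T (outsideThroughHub false (cs i))) → Plan k cs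
atDistance2Plan {1}           cs (s≤s ())
atDistance2Plan {suc (suc k)} cs _ r≤1 ¬nb ¬throughHub =
  outsidePlan cs false r≤1 (λ i e → ⊥-elim (¬throughHub i e)) (inj₂ (0F , 1F , (λ ()) , at 0F , at 1F))
  where
  at : ∀ i → HubAtDistance2 (cs i) (Outside false (cs i))
  at i = hubAtDistance2 (cs i) (r≤1 i) (¬nb i) (¬throughHub i)

avoid-two : ∀ {m} (i j : Fin (3 + m)) → Σ[ l ∈ Fin (3 + m) ] (l ≢ i × l ≢ j)
avoid-two (suc _)       (suc _)       = 0F , (λ ()) , (λ ())
avoid-two 0F            0F            = 1F , (λ ()) , (λ ())
avoid-two 0F            1F            = 2F , (λ ()) , (λ ())
avoid-two 0F            (suc (suc _)) = 1F , (λ ()) , (λ ())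
avoid-two 1F            0F            = 2F , (λ ()) , (λ ())
avoid-two (suc (suc _)) 0F            = 1F , (λ ()) , (λ ())

extensionPlan : ∀ {k} (cs : Fin k → Comp) → 2 ≤ k → ¬ Iso (FAdj k cs) G4 → ¬ Iso (FAdj k cs) G5 →
  sum (residue ∘ cs) ≤ 1 → (∀ i → ¬ HubNeighbour (cs i) (Outside false (cs i))) →
  (w : Fin k) → T (outsideThroughHub false (cs w)) → Plan k cs
extensionPlan {1} cs (s≤s ())
extensionPlan {2} cs _ ¬G4 ¬G5 R≤1 ¬nb w e =
  ⊥-elim ([ ¬G4 , ¬G5 ]′ (twoComponents cs w (throughHub⇒C₄,₁⊎C₅ (cs w) e) (others-C₄ cs R≤1 ¬nb w e)))
extensionPlan {suc (suc (suc k))} cs _ _ _ R≤1 ¬nb w e =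
  outsidePlan cs true (sum≤⇒≤ (residue ∘ cs) R≤1) throughHub-ok (inj₁ (j , neighbour j j≢w))
  where
  neighbour : ∀ j → j ≢ w → HubNeighbour (cs j) (Outside true (cs j))
  neighbour j j≢w =
    subst (λ c → HubNeighbour c (Outside true c)) (sym (others-C₄ cs R≤1 ¬nb w e j j≢w)) C₄-hubNeighbour

  j : Fin (3 + k)
  j = proj₁ (avoid-two w w)

  j≢w : j ≢ w
  j≢w = proj₁ (proj₂ (avoid-two w w))

  throughHub-ok : ∀ i → T (outsideThroughHub true (cs i)) → Σ[ j ∈ Fin (3 + k) ] (i ≢ j × HubNeighbour (cs j) (Outside true (cs j)))
  throughHub-ok i _ with avoid-two i w
  ... | l , l≢i , l≢w = l , ≢-sym l≢i , neighbour l l≢w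

planWithoutHub : ∀ {k} (cs : Fin k → Comp) → 2 ≤ k → ¬ Iso (FAdj k cs) G4 → ¬ Iso (FAdj k cs) G5 →
  sum (residue ∘ cs) ≤ 1 → Plan k cs
planWithoutHub cs 2≤k ¬G4 ¬G5 R≤1
  with any? (λ j → hubNeighbour? (cs j) (Outside false (cs j))) | any? (λ w → T? (outsideThroughHub false (cs w)))
... | yes (j , nb) | _           = neighbourPlan cs (sum≤⇒≤ (residue ∘ cs) R≤1) j nb
... | no ¬nb       | no ¬throughHub     =
  atDistance2Plan cs 2≤k (sum≤⇒≤ (residue ∘ cs) R≤1) (λ i → ¬nb ∘ (i ,_)) (λ i → ¬throughHub ∘ (i ,_))
... | no ¬nb       | yes (w , e) = extensionPlan cs 2≤k ¬G4 ¬G5 R≤1 (λ i → ¬nb ∘ (i ,_)) w e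

plan : ∀ {k} (cs : Fin k → Comp) → 2 ≤ k → ¬ Iso (FAdj k cs) G4 → ¬ Iso (FAdj k cs) G5 → Plan k cs
plan cs 2≤k ¬G4 ¬G5 with 2 ≤? sum (residue ∘ cs)
... | yes 2≤R = hubPlan cs 2≤R
... | no 2≰R  = planWithoutHub cs 2≤k ¬G4 ¬G5 (ℕ.≤-pred (ℕ.≰⇒> 2≰R))

lemma2p4 : (n : ℕ) (Adj : Fin n → Fin n → Set)
           (k : ℕ) (cs : Fin k → Comp) → 2 ≤ k →
           Iso Adj (FAdj k cs) →
           ¬ Iso Adj G4 → ¬ Iso Adj G5 →
           Σ[ S ∈ Subset n ] (IsDisjDom Adj S × 3 * ∣ S ∣ ≤ n)
lemma2p4 n Adj k cs 2≤k iso ¬G4 ¬G5 =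
  realise iso (plan cs 2≤k (¬G4 ∘ Iso-trans {C = G4} iso) (¬G5 ∘ Iso-trans {C = G5} iso))
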